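{- Let $k\geq 2$ and let $H$ be a finite simple graph with at least one vertex that does not contain a (nonempty) subgraph of minimum degree at least $k$. Then there exists a set $S\subseteq V_{\leq k-1}(H)$ with $|S|\leq 2(k-1)v_H-2e_H$ such that every $(H,S,k)$-cover contains a nonempty subgraph of minimum degree at least $k$.
   Context: For a graph $H$, $v_H$ and $e_H$ denote its numbers of vertices and edges, and $V_{\leq i}(H)$ denotes the set of vertices of $H$ of degree at most $i$ in $H$. Given a graph $H$, a set $S\subseteq V(H)$ and $k\geq 2$, a graph $\tilde H$ is an $(H,S,k)$-cover if it contains $H$ as a subgraph and $V_{\leq k-1}(\tilde H)\subseteq V(H)\setminus S$, i.e. every vertex of $\tilde H$ of degree at most $k-1$ in $\tilde H$ lies in $V(H)$ and not in $S$. -}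

module Defs where

open import Data.Nat using (ℕ; zero; suc; _+_; _*_; _∸_; _≤_; _<ᵇ_)
open import Data.Bool using (Bool; true; false; if_then_else_; _∧_; T)
open import Data.Fin using (Fin; toℕ) renaming (zero to fz; suc to fs)
open import Data.Product using (Σ; _×_; ∃)
open import Relation.Binary.PropositionalEquality using (_≡_)
open import Function.Definitions using (Injective)

count : ∀ {n} → (Fin n → Bool) → ℕ
count {zero}  f = 0
count {suc n} f = (if f fz then 1 else 0) + count (λ i → f (fs i))

record Graph : Set where
  field
    n      : ℕ
    adj    : Fin n → Fin n → Bool
    sym    : ∀ u v → adj u v ≡ adj v u
    irrefl : ∀ v → adj v v ≡ false

open Graph public

vCount : Graph → ℕ
vCount G = n G

degree : (G : Graph) → Fin (n G) → ℕ
degree G v = count (adj G v)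

sumFin : ∀ {m} → (Fin m → ℕ) → ℕ
sumFin {zero}  f = 0
sumFin {suc m} f = f fz + sumFin (λ i → f (fs i))

eCount : Graph → ℕ
eCount G = sumFin (λ u → count (λ v → (toℕ u <ᵇ toℕ v) ∧ adj G u v))

-- a (not necessarily induced) subgraph of G: vertex set U, edge set F ⊆ E(G)
-- with both ends of every edge in U; nonempty and of minimum degree ≥ k
record MinDegSubgraph (k : ℕ) (G : Graph) : Set where
  field
    U       : Fin (n G) → Bool
    F       : Fin (n G) → Fin (n G) → Bool
    F-sym   : ∀ u v → F u v ≡ F v u
    F⊆E     : ∀ u v → F u v ≡ true → adj G u v ≡ true
    F-ends  : ∀ u v → F u v ≡ true → U u ≡ true
    nonempty : ∃ λ u → U u ≡ true
    minDeg  : ∀ u → U u ≡ true → k ≤ count (F u)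

-- (H,S,k)-cover: a graph G containing H as a subgraph (via the vertex
-- identification f) such that every vertex of degree ≤ k-1 in G lies in
-- f(V(H) \ S)
record Cover (H : Graph) (S : Fin (n H) → Bool) (k : ℕ) (G : Graph) : Set where
  field
    f       : Fin (n H) → Fin (n G)
    f-inj   : Injective _≡_ _≡_ f
    f-edges : ∀ u v → adj H u v ≡ true → adj G (f u) (f v) ≡ true
    lowDeg  : ∀ w → degree G w ≤ k ∸ 1 →
              Σ (Fin (n H)) λ v → (f v ≡ w) × (S v ≡ false)

module Submission where

-- Write K = k - 1. As H has no (K+1)-core, every nonempty vertex set A has a
-- vertex v with at most K neighbours inside A, so S can be built by induction
-- on |A|: given a selection S' for A ∖ v, either v is added (together with the
-- vertices of S' whose degree in A is still ≤ K), or, when v has exactly K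
-- neighbours in A and none of them in S', S' is kept. The invariant (record
-- Admissible) asks that S ⊆ A has degrees ≤ K in H[A], that the potential
-- Σ_{x∈S} (1 + K - deg_A x) plus 2 e(H[A]) is at most 2K|A|, and that S forces
-- a (K+1)-core: in any graph G containing H, a nonempty vertex set B whose
-- vertices of degree ≤ K in G[B] are all images of A ∖ S spans such a core.
-- For A = V(H) and B = V(G) this is the theorem, because |S| is at most the
-- potential and the degree sum is 2e_H (handshake lemma).

open import Defs renaming (sym to adj-sym)
open import Data.Nat
  using (ℕ; zero; suc; _+_; _*_; _∸_; _≤_; _<_; _≤?_; _≤ᵇ_; _<ᵇ_; z≤n; s≤s)
open import Data.Nat.Properties
  using ( +-0-commutativeMonoid; +-comm; +-suc; +-identityʳ; +-mono-≤; +-monoˡ-≤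
        ; m≤m+n; ≤-trans; ≤-reflexive; ≤-antisym; ≤-pred; n≮0; n<1+n; <⇒≱; ≰⇒>
        ; suc-injective; <-cmp; <⇒<ᵇ; <ᵇ⇒<; ≤ᵇ⇒≤; ≤⇒≤ᵇ
        ; ∸-monoʳ-≤; ∸-monoʳ-<; m∸n+n≡m
        ; module ≤-Reasoning )
open import Data.Nat.Tactic.RingSolver using (solve-∀)
open import Data.Bool using (Bool; true; false; if_then_else_; not; _∧_; _∨_)
open import Data.Bool.Properties using (¬-not; ∧-zeroʳ; T-≡) renaming (_≟_ to _≟ᵇ_)
open import Data.Fin using (Fin; toℕ; fromℕ<; _≟_) renaming (zero to fz; suc to fs)
open import Data.Fin.Properties using (punchInᵢ≢i; toℕ-injective; any?; 0≢1+n)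
  renaming (suc-injective to fs-injective)
open import Data.Vec.Functional using (removeAt)
open import Data.Product using (Σ; _×_; _,_; proj₁; proj₂)
open import Data.Sum using (_⊎_; inj₁; inj₂)
open import Data.Empty using (⊥-elim)
open import Function using (_∘_; flip)
open import Function.Bundles using (Equivalence)
open import Relation.Binary using (tri<; tri≈; tri>)
open import Relation.Nullary using (¬_; yes; no; does)
open import Relation.Nullary.Decidable using (dec-true; dec-false; _×-dec_)
open import Relation.Binary.PropositionalEquality
  using (_≡_; _≢_; refl; sym; trans; cong; cong₂; subst; module ≡-Reasoning)
open import Algebra.Properties.CommutativeMonoid.Sum +-0-commutativeMonoid
  using (sum; sum-cong-≗; ∑-distrib-+; ∑-comm; sum-remove)

sumFin≡sum : ∀ {m} (g : Fin m → ℕ) → sumFin g ≡ sum g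
sumFin≡sum {zero}  g = refl
sumFin≡sum {suc m} g = cong (g fz +_) (sumFin≡sum (g ∘ fs))

sum-cong : ∀ {m} {g h : Fin m → ℕ} → (∀ x → g x ≡ h x) → sumFin g ≡ sumFin h
sum-cong {zero}  eq = refl
sum-cong {suc m} eq = cong₂ _+_ (eq fz) (sum-cong (eq ∘ fs))

sum-distrib : ∀ {m} (g h : Fin m → ℕ) →
              sumFin (λ x → g x + h x) ≡ sumFin g + sumFin h
sum-distrib g h = begin
    sumFin (λ x → g x + h x)  ≡⟨ sumFin≡sum (λ x → g x + h x) ⟩
    sum (λ x → g x + h x)     ≡⟨ ∑-distrib-+ g h ⟩
    sum g + sum h             ≡⟨ sym (cong₂ _+_ (sumFin≡sum g) (sumFin≡sum h)) ⟩
    sumFin g + sumFin h       ∎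
  where open ≡-Reasoning

sum-swap : ∀ {m p} (g : Fin m → Fin p → ℕ) →
           sumFin (λ u → sumFin (g u)) ≡ sumFin (λ v → sumFin (λ u → g u v))
sum-swap g = begin
    sumFin (λ u → sumFin (g u))      ≡⟨ double g ⟩
    sum (λ u → sum (g u))            ≡⟨ ∑-comm g ⟩
    sum (λ v → sum (λ u → g u v))    ≡⟨ sym (double (flip g)) ⟩
    sumFin (λ v → sumFin (λ u → g u v)) ∎
  where
  open ≡-Reasoning
  double : ∀ {m p} (g : Fin m → Fin p → ℕ) →
           sumFin (λ u → sumFin (g u)) ≡ sum (λ u → sum (g u))
  double g = trans (sumFin≡sum (λ u → sumFin (g u))) (sum-cong-≗ (λ u → sumFin≡sum (g u)))

sum-update : ∀ {m} (g h : Fin m → ℕ) (v : Fin m) → (∀ x → x ≢ v → g x ≡ h x) →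
             sumFin g + h v ≡ sumFin h + g v
sum-update {suc m} g h v agree = begin
    sumFin g + h v                   ≡⟨ cong (_+ h v) (trans (sumFin≡sum g) (sum-remove g)) ⟩
    g v + sum (removeAt g v) + h v   ≡⟨ cong (λ r → g v + r + h v) rest ⟩
    g v + sum (removeAt h v) + h v   ≡⟨ swap (g v) (sum (removeAt h v)) (h v) ⟩
    h v + sum (removeAt h v) + g v   ≡⟨ sym (cong (_+ g v) (trans (sumFin≡sum h) (sum-remove h))) ⟩
    sumFin h + g v                   ∎
  where
  open ≡-Reasoning
  rest : sum (removeAt g v) ≡ sum (removeAt h v)
  rest = sum-cong-≗ (λ j → agree _ (punchInᵢ≢i v j))
  swap : ∀ a r b → a + r + b ≡ b + r + a
  swap = solve-∀

sum-mono : ∀ {m} {g h : Fin m → ℕ} → (∀ x → g x ≤ h x) → sumFin g ≤ sumFin h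
sum-mono {zero}  le = z≤n
sum-mono {suc m} le = +-mono-≤ (le fz) (sum-mono (le ∘ fs))

sum-mono-< : ∀ {m} {g h : Fin m → ℕ} → (∀ x → g x ≤ h x) → (t : Fin m) → g t < h t →
             sumFin g < sumFin h
sum-mono-< {suc m} le fz     lt = +-mono-≤ lt (sum-mono (le ∘ fs))
sum-mono-< {suc m} {g} {h} le (fs t) lt =
  subst (_≤ sumFin h) (+-suc (g fz) _) (+-mono-≤ (le fz) (sum-mono-< (le ∘ fs) t lt))

sum-zero : ∀ {m} (g : Fin m → ℕ) → (∀ x → g x ≡ 0) → sumFin g ≡ 0
sum-zero {zero}  g vanish = refl
sum-zero {suc m} g vanish = cong₂ _+_ (vanish fz) (sum-zero (g ∘ fs) (vanish ∘ fs))

∧-intro : ∀ {a b} → a ≡ true → b ≡ true → a ∧ b ≡ true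
∧-intro refl refl = refl

∧-elimˡ : ∀ {a b} → a ∧ b ≡ true → a ≡ true
∧-elimˡ {true} _ = refl

∧-elimʳ : ∀ {a b} → a ∧ b ≡ true → b ≡ true
∧-elimʳ {true} h = h

true≢false : true ≢ false
true≢false ()

≤ᵇ-sound : ∀ {m n} → (m ≤ᵇ n) ≡ true → m ≤ n
≤ᵇ-sound {m} {n} h = ≤ᵇ⇒≤ m n (Equivalence.from T-≡ h)

≤ᵇ-complete : ∀ {m n} → m ≤ n → (m ≤ᵇ n) ≡ true
≤ᵇ-complete m≤n = Equivalence.to T-≡ (≤⇒≤ᵇ m≤n)

ind : Bool → ℕ
ind b = if b then 1 else 0

count-as-sum : ∀ {m} (P : Fin m → Bool) → count P ≡ sumFin (ind ∘ P)
count-as-sum {zero}  P = refl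
count-as-sum {suc m} P = cong (ind (P fz) +_) (count-as-sum (P ∘ fs))

count-update : ∀ {m} (P Q : Fin m → Bool) (v : Fin m) → (∀ x → x ≢ v → P x ≡ Q x) →
               count P + ind (Q v) ≡ count Q + ind (P v)
count-update P Q v agree rewrite count-as-sum P | count-as-sum Q =
  sum-update (ind ∘ P) (ind ∘ Q) v (λ x x≢v → cong ind (agree x x≢v))

count-witness : ∀ {m} (P : Fin m → Bool) → 1 ≤ count P → Σ (Fin m) λ x → P x ≡ true
count-witness {suc m} P pos with P fz in eq
... | true  = fz , eq
... | false with count-witness (P ∘ fs) pos
...   | x , Px = fs x , Px

count-full : ∀ m → count {m} (λ _ → true) ≡ m
count-full zero    = refl
count-full (suc m) = cong suc (count-full m)

_∖_ : ∀ {m} → (Fin m → Bool) → Fin m → Fin m → Bool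
(A ∖ v) x = not (does (x ≟ v)) ∧ A x

∖-self : ∀ {m} (A : Fin m → Bool) (v : Fin m) → (A ∖ v) v ≡ false
∖-self A v rewrite dec-true (v ≟ v) refl = refl

∖-other : ∀ {m} (A : Fin m → Bool) {v x : Fin m} → x ≢ v → (A ∖ v) x ≡ A x
∖-other A {v} {x} x≢v rewrite dec-false (x ≟ v) x≢v = refl

∖-⊆ : ∀ {m} (A : Fin m → Bool) {v x : Fin m} → (A ∖ v) x ≡ true → A x ≡ true
∖-⊆ A {v} {x} h with x ≟ v
... | no _ = h

∖-≢ : ∀ {m} (A : Fin m → Bool) {v x : Fin m} → (A ∖ v) x ≡ true → x ≢ v
∖-≢ A {v} h refl = true≢false (trans (sym h) (∖-self A v))

count-remove : ∀ {m} (A : Fin m → Bool) (v : Fin m) → count (A ∖ v) + ind (A v) ≡ count A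
count-remove A v = begin
    count (A ∖ v) + ind (A v)        ≡⟨ count-update (A ∖ v) A v (λ x → ∖-other A) ⟩
    count A + ind ((A ∖ v) v)        ≡⟨ cong (λ b → count A + ind b) (∖-self A v) ⟩
    count A + 0                      ≡⟨ +-identityʳ (count A) ⟩
    count A                          ∎
  where open ≡-Reasoning

count-remove-member : ∀ {m} (A : Fin m → Bool) {v : Fin m} → A v ≡ true →
                      suc (count (A ∖ v)) ≡ count A
count-remove-member A {v} Av = begin
    suc (count (A ∖ v))         ≡⟨ +-comm 1 (count (A ∖ v)) ⟩
    count (A ∖ v) + 1           ≡⟨ cong (λ b → count (A ∖ v) + ind b) (sym Av) ⟩
    count (A ∖ v) + ind (A v)   ≡⟨ count-remove A v ⟩
    count A                     ∎
  where open ≡-Reasoning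

count-remove-≤ : ∀ {m} (A : Fin m → Bool) (v : Fin m) → count (A ∖ v) ≤ count A
count-remove-≤ A v = subst (count (A ∖ v) ≤_) (count-remove A v) (m≤m+n _ _)

count-pos : ∀ {m} (P : Fin m → Bool) {x : Fin m} → P x ≡ true → 1 ≤ count P
count-pos P Px = subst (1 ≤_) (count-remove-member P Px) (s≤s z≤n)

count-zero : ∀ {m} (P : Fin m → Bool) → count P ≡ 0 → ∀ x → P x ≡ false
count-zero P none x = ¬-not (λ Px → n≮0 (subst (1 ≤_) none (count-pos P Px)))

count-remove-size : ∀ {m k} (A : Fin m → Bool) (v : Fin m) → A v ≡ true →
                    count A ≡ suc k → count (A ∖ v) ≡ k
count-remove-size A v Av size = suc-injective (trans (count-remove-member A Av) size)

count-injective : ∀ {m p} (P : Fin m → Bool) (Q : Fin p → Bool) (f : Fin m → Fin p) →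
                  (∀ {x y} → f x ≡ f y → x ≡ y) →
                  (∀ x → P x ≡ true → Q (f x) ≡ true) →
                  count P ≤ count Q
count-injective {zero}  P Q f inj into = z≤n
count-injective {suc m} P Q f inj into
  with P fz in P0 | count-injective (P ∘ fs) (Q ∖ f fz) (f ∘ fs) (fs-injective ∘ inj)
                      (λ x Px → trans (∖-other Q (0≢1+n ∘ sym ∘ inj)) (into (fs x) Px))
... | true  | tail≤ = ≤-trans (s≤s tail≤) (≤-reflexive (count-remove-member Q (into fz P0)))
... | false | tail≤ = ≤-trans tail≤ (count-remove-≤ Q (f fz))

count-injective-strict : ∀ {m p} (P : Fin m → Bool) (Q : Fin p → Bool) (f : Fin m → Fin p) →
                         (∀ {x y} → f x ≡ f y → x ≡ y) →
                         (∀ x → P x ≡ true → Q (f x) ≡ true) →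
                         (w : Fin p) → Q w ≡ true → (∀ x → P x ≡ true → f x ≢ w) →
                         count P < count Q
count-injective-strict P Q f inj into w Qw missed = begin
    suc (count P)        ≤⟨ s≤s (count-injective P (Q ∖ w) f inj into∖w) ⟩
    suc (count (Q ∖ w))  ≡⟨ count-remove-member Q Qw ⟩
    count Q              ∎
  where
  open ≤-Reasoning
  into∖w : ∀ x → P x ≡ true → (Q ∖ w) (f x) ≡ true
  into∖w x Px = trans (∖-other Q (missed x Px)) (into x Px)

degIn : (Γ : Graph) → (Fin (n Γ) → Bool) → Fin (n Γ) → ℕ
degIn Γ A x = count (λ y → A y ∧ adj Γ x y)

degIn-remove : (Γ : Graph) (A : Fin (n Γ) → Bool) (v x : Fin (n Γ)) → A v ≡ true →
               degIn Γ A x ≡ degIn Γ (A ∖ v) x + ind (adj Γ x v)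
degIn-remove Γ A v x Av = sym (settle (count-update P Q v agree))
  where
  P Q : Fin (n Γ) → Bool
  P y = (A ∖ v) y ∧ adj Γ x y
  Q y = A y ∧ adj Γ x y
  agree : ∀ y → y ≢ v → P y ≡ Q y
  agree y y≢v = cong (_∧ adj Γ x y) (∖-other A y≢v)
  settle : count P + ind (Q v) ≡ count Q + ind (P v) → count P + ind (adj Γ x v) ≡ count Q
  settle eq rewrite ∖-self A v | Av | +-identityʳ (count Q) = eq

degIn-remove-non-adjacent : (Γ : Graph) (A : Fin (n Γ) → Bool) (v x : Fin (n Γ)) → A v ≡ true →
                            adj Γ x v ≡ false → degIn Γ A x ≡ degIn Γ (A ∖ v) x
degIn-remove-non-adjacent Γ A v x Av xv = begin
    degIn Γ A x                           ≡⟨ degIn-remove Γ A v x Av ⟩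
    degIn Γ (A ∖ v) x + ind (adj Γ x v)   ≡⟨ cong (λ b → degIn Γ (A ∖ v) x + ind b) xv ⟩
    degIn Γ (A ∖ v) x + 0                 ≡⟨ +-identityʳ _ ⟩
    degIn Γ (A ∖ v) x                     ∎
  where open ≡-Reasoning

degIn-remove-adjacent : (Γ : Graph) (A : Fin (n Γ) → Bool) (v x : Fin (n Γ)) → A v ≡ true →
                        adj Γ x v ≡ true → degIn Γ A x ≡ suc (degIn Γ (A ∖ v) x)
degIn-remove-adjacent Γ A v x Av xv = begin
    degIn Γ A x                           ≡⟨ degIn-remove Γ A v x Av ⟩
    degIn Γ (A ∖ v) x + ind (adj Γ x v)   ≡⟨ cong (λ b → degIn Γ (A ∖ v) x + ind b) xv ⟩
    degIn Γ (A ∖ v) x + 1                 ≡⟨ +-comm _ 1 ⟩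
    suc (degIn Γ (A ∖ v) x)               ∎
  where open ≡-Reasoning

degIn-remove-≤ : (Γ : Graph) (A : Fin (n Γ) → Bool) (v x : Fin (n Γ)) → A v ≡ true →
                 degIn Γ (A ∖ v) x ≤ degIn Γ A x
degIn-remove-≤ Γ A v x Av =
  subst (degIn Γ (A ∖ v) x ≤_) (sym (degIn-remove Γ A v x Av)) (m≤m+n _ _)

-- Handshake lemma: every edge uv is counted once from below (u < v) by eCount
-- and twice in the degree sum.
below : ∀ {m} → Fin m → Fin m → Bool
below u v = toℕ u <ᵇ toℕ v

below-true : ∀ {m} {u v : Fin m} → toℕ u < toℕ v → below u v ≡ true
below-true u<v = Equivalence.to T-≡ (<⇒<ᵇ u<v)

below-false : ∀ {m} {u v : Fin m} → ¬ toℕ u < toℕ v → below u v ≡ false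
below-false {u = u} {v} u≮v with below u v in eq
... | true  = ⊥-elim (u≮v (<ᵇ⇒< (toℕ u) (toℕ v) (Equivalence.from T-≡ eq)))
... | false = refl

-- Each adjacency u ~ v is seen from exactly one side, since u ≠ v.
adjacency-split : (Γ : Graph) (u v : Fin (n Γ)) →
                  ind (adj Γ u v) ≡ ind (below u v ∧ adj Γ u v) + ind (below v u ∧ adj Γ u v)
adjacency-split Γ u v with <-cmp (toℕ u) (toℕ v)
... | tri< u<v _ v≮u rewrite below-true u<v | below-false v≮u = sym (+-identityʳ _)
... | tri> u≮v _ v<u rewrite below-false u≮v | below-true v<u = refl
... | tri≈ u≮v u≡v _ rewrite toℕ-injective u≡v | below-false u≮v | irrefl Γ v = refl

handshake : (Γ : Graph) → 2 * eCount Γ ≡ sumFin (λ u → count (adj Γ u))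
handshake Γ = begin
    2 * eCount Γ                  ≡⟨ cong (eCount Γ +_) (+-identityʳ (eCount Γ)) ⟩
    eCount Γ + eCount Γ           ≡⟨ cong₂ _+_ upper≡ (trans upper≡ mirror) ⟩
    ΣΣ upper + ΣΣ lower           ≡⟨ sym (sum-distrib (sumFin ∘ upper) (sumFin ∘ lower)) ⟩
    sumFin (λ u → sumFin (upper u) + sumFin (lower u))
                                  ≡⟨ sum-cong (λ u → sym (sum-distrib (upper u) (lower u))) ⟩
    sumFin (λ u → sumFin (λ v → upper u v + lower u v))
                                  ≡⟨ sum-cong (λ u → sum-cong (sym ∘ adjacency-split Γ u)) ⟩
    sumFin (λ u → sumFin (ind ∘ adj Γ u))
                                  ≡⟨ sum-cong (λ u → sym (count-as-sum (adj Γ u))) ⟩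
    sumFin (λ u → count (adj Γ u)) ∎
  where
  open ≡-Reasoning
  upper lower : Fin (n Γ) → Fin (n Γ) → ℕ
  upper u v = ind (below u v ∧ adj Γ u v)
  lower u v = ind (below v u ∧ adj Γ u v)
  ΣΣ : (Fin (n Γ) → Fin (n Γ) → ℕ) → ℕ
  ΣΣ g = sumFin (λ u → sumFin (g u))
  upper≡ : eCount Γ ≡ ΣΣ upper
  upper≡ = sum-cong (λ u → count-as-sum (λ v → below u v ∧ adj Γ u v))
  mirror : ΣΣ upper ≡ ΣΣ lower
  mirror = begin
    ΣΣ upper          ≡⟨ sum-cong (λ u → sum-cong (λ v → cong (λ b → ind (below u v ∧ b))
                                                              (adj-sym Γ u v))) ⟩
    ΣΣ (flip lower)   ≡⟨ sum-swap (flip lower) ⟩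
    ΣΣ lower          ∎

adj-≢ : (Γ : Graph) {u v : Fin (n Γ)} → adj Γ v u ≡ true → u ≢ v
adj-≢ Γ {v = v} vu refl = true≢false (trans (sym vu) (irrefl Γ v))

record _↪_ (H G : Graph) : Set where
  field
    map       : Fin (n H) → Fin (n G)
    injective : ∀ {x y} → map x ≡ map y → x ≡ y
    adjacent  : ∀ u v → adj H u v ≡ true → adj G (map u) (map v) ≡ true

open _↪_

degIn-embed : ∀ {H G} (e : H ↪ G) (A : Fin (n H) → Bool) (B : Fin (n G) → Bool) →
              (∀ u → A u ≡ true → B (map e u) ≡ true) →
              ∀ u → degIn H A u ≤ degIn G B (map e u)
degIn-embed e A B A⊆B u =
  count-injective _ _ (map e) (injective e)
    (λ y h → ∧-intro (A⊆B y (∧-elimˡ h)) (adjacent e u y (∧-elimʳ {A y} h)))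

core-from-set : ∀ k (Γ : Graph) (U : Fin (n Γ) → Bool) → Σ (Fin (n Γ)) (λ u → U u ≡ true) →
                (∀ u → U u ≡ true → k ≤ degIn Γ U u) → MinDegSubgraph k Γ
core-from-set k Γ U nonempty dense = record
  { U        = U
  ; F        = λ x y → U x ∧ U y ∧ adj Γ x y
  ; F-sym    = F-sym
  ; F⊆E      = λ u v h → ∧-elimʳ {U v} (∧-elimʳ {U u} h)
  ; F-ends   = λ u v h → ∧-elimˡ h
  ; nonempty = nonempty
  ; minDeg   = minDeg
  }
  where
  F-sym : ∀ u v → U u ∧ U v ∧ adj Γ u v ≡ U v ∧ U u ∧ adj Γ v u
  F-sym u v with U u | U v
  ... | true  | true  = adj-sym Γ u v
  ... | true  | false = refl
  ... | false | true  = refl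
  ... | false | false = refl
  minDeg : ∀ u → U u ≡ true → k ≤ count (λ y → U u ∧ U y ∧ adj Γ u y)
  minDeg u Uu rewrite Uu = dense u Uu

low-vertex : ∀ K (Γ : Graph) → ¬ MinDegSubgraph (suc K) Γ →
             (A : Fin (n Γ) → Bool) → Σ (Fin (n Γ)) (λ u → A u ≡ true) →
             Σ (Fin (n Γ)) λ v → A v ≡ true × degIn Γ A v ≤ K
low-vertex K Γ noCore A nonempty with any? (λ v → (A v ≟ᵇ true) ×-dec (degIn Γ A v ≤? K))
... | yes found = found
... | no none    = ⊥-elim (noCore (core-from-set (suc K) Γ A nonempty dense))
  where
  dense : ∀ u → A u ≡ true → suc K ≤ degIn Γ A u
  dense u Au with degIn Γ A u ≤? K
  ... | yes low = ⊥-elim (none (u , Au , low))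
  ... | no high = ≰⇒> high

cover-embedding : ∀ {H S k G} → Cover H S k G → H ↪ G
cover-embedding c = record
  { map = Cover.f c ; injective = Cover.f-inj c ; adjacent = Cover.f-edges c }

-- The construction for a fixed graph H and degree bound K = k - 1; vertex sets
-- of H are Boolean predicates and deg A x is the degree of x in H[A].
module Construction (K : ℕ) (H : Graph) where

  VSet : Set
  VSet = Fin (n H) → Bool

  deg : VSet → Fin (n H) → ℕ
  deg = degIn H

  -- Sum of inner degrees over A, i.e. twice the number of edges of H[A].
  edgeSum : VSet → ℕ
  edgeSum A = sumFin (λ x → if A x then deg A x else 0)

  charge : VSet → VSet → Fin (n H) → ℕ
  charge A S x = if S x then suc (K ∸ deg A x) else 0

  potential : VSet → VSet → ℕ
  potential A S = sumFin (charge A S)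

  charge-selected : ∀ A {S x} → S x ≡ true → charge A S x ≡ suc (K ∸ deg A x)
  charge-selected A {x = x} Sx = cong (λ b → if b then suc (K ∸ deg A x) else 0) Sx

  charge-unselected : ∀ A {S x} → S x ≡ false → charge A S x ≡ 0
  charge-unselected A {x = x} Sx = cong (λ b → if b then suc (K ∸ deg A x) else 0) Sx

  record Covered {G : Graph} (e : H ↪ G) (A S : VSet) (B : Fin (n G) → Bool) : Set where
    field
      image : ∀ u → A u ≡ true → B (map e u) ≡ true
      low   : ∀ w → B w ≡ true → degIn G B w ≤ K →
              Σ (Fin (n H)) λ u → A u ≡ true × map e u ≡ w × S u ≡ false

  Forcing : VSet → VSet → Set
  Forcing A S = ∀ {G} (e : H ↪ G) (B : Fin (n G) → Bool) →
                Σ (Fin (n G)) (λ w → B w ≡ true) → Covered e A S B → MinDegSubgraph (suc K) G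

  -- The invariant maintained while vertices are added back in degeneracy order.
  record Admissible (A S : VSet) : Set where
    field
      within     : ∀ x → S x ≡ true → A x ≡ true
      low-degree : ∀ x → S x ≡ true → deg A x ≤ K
      budget     : potential A S + edgeSum A ≤ 2 * K * count A
      forcing    : Forcing A S

  -- Removing v ∈ A deletes its deg A v edges, each counted twice in edgeSum.
  edgeSum-remove : ∀ A v → A v ≡ true → edgeSum A ≡ edgeSum (A ∖ v) + 2 * deg A v
  edgeSum-remove A v Av = begin
      edgeSum A                     ≡⟨ sym (settle (sum-update g h v agree)) ⟩
      sumFin g + deg A v            ≡⟨ cong (_+ deg A v) split ⟩
      edgeSum A' + deg A' v + deg A v ≡⟨ cong (λ z → edgeSum A' + z + deg A v) (sym v-unaffected) ⟩
      edgeSum A' + deg A v + deg A v  ≡⟨ double (edgeSum A') (deg A v) ⟩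
      edgeSum A' + 2 * deg A v      ∎
    where
    open ≡-Reasoning
    A' : VSet
    A' = A ∖ v
    -- v is not its own neighbour
    v-unaffected : deg A v ≡ deg A' v
    v-unaffected = degIn-remove-non-adjacent H A v v Av (irrefl H v)
    g h : Fin (n H) → ℕ
    g x = if A' x then deg A x else 0
    h x = if A x then deg A x else 0
    agree : ∀ x → x ≢ v → g x ≡ h x
    agree x x≢v = cong (λ b → if b then deg A x else 0) (∖-other A x≢v)
    settle : sumFin g + h v ≡ sumFin h + g v → sumFin g + deg A v ≡ edgeSum A
    settle eq rewrite ∖-self A v | Av = trans eq (+-identityʳ _)
    pointwise : ∀ x → g x ≡ (if A' x then deg A' x else 0) + ind (A' x ∧ adj H v x)
    pointwise x with A' x
    ... | true  = trans (degIn-remove H A v x Av) (cong (λ b → deg A' x + ind b) (adj-sym H x v))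
    ... | false = refl
    split : sumFin g ≡ edgeSum A' + deg A' v
    split = begin
      sumFin g                               ≡⟨ sum-cong pointwise ⟩
      sumFin (λ x → inner x + ind (near x))  ≡⟨ sum-distrib inner (ind ∘ near) ⟩
      edgeSum A' + sumFin (ind ∘ near)       ≡⟨ cong (edgeSum A' +_) (sym (count-as-sum near)) ⟩
      edgeSum A' + deg A' v                  ∎
      where
      inner : Fin (n H) → ℕ
      inner x = if A' x then deg A' x else 0
      near : VSet
      near x = A' x ∧ adj H v x
    double : ∀ a b → a + b + b ≡ a + 2 * b
    double = solve-∀

  cover-restrict : ∀ {G} {e : H ↪ G} {A S S' B} v → Covered e A S B →
                   (∀ u → A u ≡ true → S u ≡ false → degIn G B (map e u) ≤ K →
                          u ≢ v × S' u ≡ false) →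
                   Covered e (A ∖ v) S' B
  cover-restrict {G} {e} {A} {S} {S'} {B} v cov survives = record
    { image = λ u A'u → Covered.image cov u (∖-⊆ A A'u)
    ; low   = low
    }
    where
    low : ∀ w → B w ≡ true → degIn G B w ≤ K →
          Σ (Fin (n H)) λ u → (A ∖ v) u ≡ true × map e u ≡ w × S' u ≡ false
    low w Bw small with Covered.low cov w Bw small
    ... | u , Au , eu≡w , Su with survives u Au Su (subst (λ z → degIn G B z ≤ K) (sym eu≡w) small)
    ...   | u≢v , S'u = u , trans (∖-other A u≢v) Au , eu≡w , S'u

  -- If the image of v has more than K neighbours in B, it is never a low vertex.
  cover-drop-high : ∀ {G} {e : H ↪ G} {A S B} v → Covered e A S B →
                    K < degIn G B (map e v) → Covered e (A ∖ v) S B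
  cover-drop-high v cov high =
    cover-restrict v cov (λ u _ Su small → (λ { refl → <⇒≱ high small }) , Su)

  neighbour-preimage : ∀ {G} {e : H ↪ G} {A S B} v → Covered e A S B →
                       K ≤ deg A v → degIn G B (map e v) ≤ K →
                       ∀ w → B w ≡ true → adj G (map e v) w ≡ true →
                       Σ (Fin (n H)) λ u → (A u ∧ adj H v u) ≡ true × map e u ≡ w
  neighbour-preimage {G} {e} {A} {B = B} v cov K≤d small w Bw adj-w
    with any? (λ u → ((A u ∧ adj H v u) ≟ᵇ true) ×-dec (map e u ≟ w))
  ... | yes found = found
  ... | no missed = ⊥-elim (<⇒≱ (≤-trans (s≤s K≤d) larger) small)
    where
    larger : deg A v < degIn G B (map e v)
    larger = count-injective-strict _ _ (map e) (injective e)
               (λ y h → ∧-intro (Covered.image cov y (∧-elimˡ h))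
                                (adjacent e v y (∧-elimʳ {A y} h)))
               w (∧-intro Bw adj-w) (λ y h eq → missed (y , h , eq))

  -- When the image of v has at most K neighbours in B, delete it from B: each
  -- vertex whose degree drops is the image of a neighbour of v, and no
  -- neighbour of v lies in S.
  cover-delete-low : ∀ {G} {e : H ↪ G} {A S B} v → A v ≡ true → Covered e A S B →
                     K ≤ deg A v → degIn G B (map e v) ≤ K →
                     (∀ t → S t ≡ true → adj H v t ≡ false) →
                     Covered e (A ∖ v) S (B ∖ map e v)
  cover-delete-low {G} {e} {A} {S} {B} v Av cov K≤d small isolated = record
    { image = λ u A'u → trans (∖-other B (∖-≢ A A'u ∘ injective e))
                              (Covered.image cov u (∖-⊆ A A'u))
    ; low   = low
    }
    where
    B' : Fin (n G) → Bool
    B' = B ∖ map e v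
    low : ∀ w → B' w ≡ true → degIn G B' w ≤ K →
          Σ (Fin (n H)) λ u → (A ∖ v) u ≡ true × map e u ≡ w × S u ≡ false
    low w B'w small-w with adj G w (map e v) in adj-w
    ... | false with Covered.low cov w (∖-⊆ B B'w) small-in-B
      where
      small-in-B : degIn G B w ≤ K
      small-in-B = subst (_≤ K) (sym (degIn-remove-non-adjacent G B (map e v) w
                                       (Covered.image cov v Av) adj-w)) small-w
    ...   | u , Au , eu≡w , Su = u , trans (∖-other A u≢v) Au , eu≡w , Su
      where
      u≢v : u ≢ v
      u≢v refl = ∖-≢ B B'w (sym eu≡w)
    low w B'w small-w | true with neighbour-preimage v cov K≤d small w (∖-⊆ B B'w)
                                    (trans (adj-sym G (map e v) w) adj-w)
    ... | u , Av∧vu , eu≡w = u , trans (∖-other A (adj-≢ H vu)) (∧-elimˡ Av∧vu) , eu≡w , Su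
      where
      vu : adj H v u ≡ true
      vu = ∧-elimʳ {A u} Av∧vu
      Su : S u ≡ false
      Su = ¬-not (λ Su → true≢false (trans (sym vu) (isolated u Su)))

  -- A neighbour of v keeps B ∖ {map e v} nonempty.
  delete-nonempty : ∀ {G} {e : H ↪ G} {A S B} v → Covered e A S B → 1 ≤ deg A v →
                    Σ (Fin (n G)) λ w → (B ∖ map e v) w ≡ true
  delete-nonempty {e = e} {A} {B = B} v cov d≥1 with count-witness _ d≥1
  ... | y , Ay∧vy = map e y , trans (∖-other B (adj-≢ H (∧-elimʳ {A y} Ay∧vy) ∘ injective e))
                                    (Covered.image cov y (∧-elimˡ Ay∧vy))

  -- The empty set has the empty selection: any covered B has minimum degree > K.
  empty-admissible : ∀ A → (∀ x → A x ≡ false) → Admissible A (λ _ → false)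
  empty-admissible A empty = record
    { within     = λ x ()
    ; low-degree = λ x ()
    ; budget     = subst (_≤ 2 * K * count A) (sym (cong₂ _+_ no-charge no-edges)) z≤n
    ; forcing    = forcing
    }
    where
    no-charge : potential A (λ _ → false) ≡ 0
    no-charge = sum-zero (charge A (λ _ → false)) (λ _ → refl)
    no-edges : edgeSum A ≡ 0
    no-edges = sum-zero _ (λ x → cong (λ b → if b then deg A x else 0) (empty x))
    forcing : Forcing A (λ _ → false)
    forcing {G} e B nonempty cov = core-from-set (suc K) G B nonempty dense
      where
      dense : ∀ w → B w ≡ true → suc K ≤ degIn G B w
      dense w Bw with degIn G B w ≤? K
      ... | no high = ≰⇒> high
      ... | yes small with Covered.low cov w Bw small
      ...   | u , Au , _ = ⊥-elim (true≢false (trans (sym Au) (empty u)))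

  module Step (A : VSet) (v : Fin (n H)) (Av : A v ≡ true) (d≤K : deg A v ≤ K)
              (S' : VSet) (adm : Admissible (A ∖ v) S') where

    A' : VSet
    A' = A ∖ v

    d : ℕ
    d = deg A v

    open Admissible adm renaming (within to within'; low-degree to low-degree';
                                  budget to budget'; forcing to forcing')

    S'-v : S' v ≡ false
    S'-v = ¬-not (λ S'v → true≢false (trans (sym (within' v S'v)) (∖-self A v)))

    budget-step : ∀ S → potential A S + 2 * d ≤ potential A' S' + 2 * K →
                  potential A S + edgeSum A ≤ 2 * K * count A
    budget-step S local = begin
      potential A S + edgeSum A              ≡⟨ cong (potential A S +_) (edgeSum-remove A v Av) ⟩
      potential A S + (edgeSum A' + 2 * d)   ≡⟨ regroup (potential A S) (edgeSum A') (2 * d) ⟩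
      potential A S + 2 * d + edgeSum A'     ≤⟨ +-monoˡ-≤ (edgeSum A') local ⟩
      potential A' S' + 2 * K + edgeSum A'   ≡⟨ swap-last (potential A' S') (2 * K) (edgeSum A') ⟩
      potential A' S' + edgeSum A' + 2 * K   ≤⟨ +-monoˡ-≤ (2 * K) budget' ⟩
      2 * K * count A' + 2 * K               ≡⟨ *-suc-right (2 * K) (count A') ⟩
      2 * K * suc (count A')                 ≡⟨ cong (2 * K *_) (count-remove-member A Av) ⟩
      2 * K * count A                        ∎
      where
      open ≤-Reasoning
      regroup : ∀ a b c → a + (b + c) ≡ a + c + b
      regroup = solve-∀
      swap-last : ∀ a b c → a + b + c ≡ a + c + b
      swap-last = solve-∀
      *-suc-right : ∀ a b → a * b + a ≡ a * suc b
      *-suc-right = solve-∀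

    -- Adding v: select v together with the vertices of S' still of degree ≤ K in A.
    -- This is affordable when v has slack or a neighbour already selected.
    CanAdd : Set
    CanAdd = suc d ≤ K ⊎ Σ (Fin (n H)) λ t → S' t ≡ true × adj H v t ≡ true

    keep : VSet
    keep x = (deg A x ≤ᵇ K) ∧ S' x

    added : VSet
    added x = does (x ≟ v) ∨ keep x

    added-v : added v ≡ true
    added-v rewrite dec-true (v ≟ v) refl = refl

    added-other : ∀ {x} → x ≢ v → added x ≡ keep x
    added-other {x} x≢v rewrite dec-false (x ≟ v) x≢v = refl

    keep-v : keep v ≡ false
    keep-v = trans (cong ((deg A v ≤ᵇ K) ∧_) S'-v) (∧-zeroʳ _)

    potential-added : potential A added ≡ potential A keep + suc (K ∸ d)
    potential-added = settle (sum-update (charge A added) (charge A keep) v agree)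
      where
      agree : ∀ x → x ≢ v → charge A added x ≡ charge A keep x
      agree x x≢v = cong (λ b → if b then suc (K ∸ deg A x) else 0) (added-other x≢v)
      settle : potential A added + charge A keep v ≡ potential A keep + charge A added v →
               potential A added ≡ potential A keep + suc (K ∸ d)
      settle eq = begin
        potential A added                    ≡⟨ sym (+-identityʳ _) ⟩
        potential A added + 0                ≡⟨ cong (potential A added +_) (sym v-not-kept) ⟩
        potential A added + charge A keep v  ≡⟨ eq ⟩
        potential A keep + charge A added v  ≡⟨ cong (potential A keep +_) v-added ⟩
        potential A keep + suc (K ∸ d)       ∎
        where
        open ≡-Reasoning
        v-not-kept : charge A keep v ≡ 0
        v-not-kept = charge-unselected A {keep} keep-v
        v-added : charge A added v ≡ suc (K ∸ d)
        v-added = charge-selected A {added} added-v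

    -- Deleting v only lowers degrees, so each kept vertex is charged no more in A
    -- than in A ∖ v, and strictly less if it is a neighbour of v.
    charge-keep-≤ : ∀ x → charge A keep x ≤ charge A' S' x
    charge-keep-≤ x with deg A x ≤ᵇ K | S' x
    ... | true  | true  = s≤s (∸-monoʳ-≤ K (degIn-remove-≤ H A v x Av))
    ... | true  | false = z≤n
    ... | false | _     = z≤n

    charge-keep-< : ∀ t → S' t ≡ true → adj H v t ≡ true → charge A keep t < charge A' S' t
    charge-keep-< t S't vt rewrite S't with deg A t ≤ᵇ K in small
    ... | false = s≤s z≤n
    ... | true  = s≤s (∸-monoʳ-< (subst (deg A' t <_) (sym deg-drop) (n<1+n _)) (≤ᵇ-sound small))
      where
      deg-drop : deg A t ≡ suc (deg A' t)
      deg-drop = degIn-remove-adjacent H A v t Av (trans (adj-sym H t v) vt)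

    -- Adding v pays for its 2d edges when v has slack (d < K) or when it has a
    -- neighbour in S', whose charge drops by one.
    added-budget : CanAdd → potential A added + 2 * d ≤ potential A' S' + 2 * K
    added-budget reason = begin
      potential A added + 2 * d             ≡⟨ cong (_+ 2 * d) potential-added ⟩
      c + suc (K ∸ d) + 2 * d               ≡⟨ unfold c (K ∸ d) d ⟩
      suc (c + (K ∸ d + d) + d)             ≡⟨ cong (λ z → suc (c + z + d)) (m∸n+n≡m d≤K) ⟩
      suc (c + K + d)                       ≤⟨ paid reason ⟩
      potential A' S' + K + K               ≡⟨ refold (potential A' S') K ⟩
      potential A' S' + 2 * K               ∎
      where
      open ≤-Reasoning
      c = potential A keep
      unfold : ∀ c s d → c + suc s + 2 * d ≡ suc (c + (s + d) + d)
      unfold = solve-∀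
      refold : ∀ p k → p + k + k ≡ p + 2 * k
      refold = solve-∀
      paid : CanAdd → suc (c + K + d) ≤ potential A' S' + K + K
      paid (inj₁ d<K) = subst (_≤ potential A' S' + K + K) (+-suc (c + K) d)
                          (+-mono-≤ (+-monoˡ-≤ K (sum-mono charge-keep-≤)) d<K)
      paid (inj₂ (t , S't , vt)) =
        +-mono-≤ (+-monoˡ-≤ K (sum-mono-< charge-keep-≤ t (charge-keep-< t S't vt))) d≤K

    added-admissible : CanAdd → Admissible A added
    added-admissible reason = record
      { within     = within
      ; low-degree = low-degree
      ; budget     = budget-step added (added-budget reason)
      ; forcing    = λ e B nonempty cov → forcing' e B nonempty (cover-restrict v cov (survives e cov))
      }
      where
      within : ∀ x → added x ≡ true → A x ≡ true
      within x h with x ≟ v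
      ... | yes refl = Av
      ... | no _     = ∖-⊆ A (within' x (∧-elimʳ {deg A x ≤ᵇ K} h))
      low-degree : ∀ x → added x ≡ true → deg A x ≤ K
      low-degree x h with x ≟ v
      ... | yes refl = d≤K
      ... | no _     = ≤ᵇ-sound (∧-elimˡ h)
      -- a low-degree image comes from u ∉ added; then u ≠ v, and u ∉ S' since
      -- deg A u is bounded by the degree of its image
      survives : ∀ {G} (e : H ↪ G) {B} → Covered e A added B →
                 ∀ u → A u ≡ true → added u ≡ false → degIn G B (map e u) ≤ K →
                 u ≢ v × S' u ≡ false
      survives e {B} cov u Au unselected small = u≢v , ¬-not S'u-absurd
        where
        u≢v : u ≢ v
        u≢v refl = true≢false (trans (sym added-v) unselected)
        S'u-absurd : S' u ≢ true
        S'u-absurd S'u = true≢false (trans (sym kept) (trans (sym (added-other u≢v)) unselected))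
          where
          kept : keep u ≡ true
          kept = ∧-intro (≤ᵇ-complete (≤-trans (degIn-embed e A B (Covered.image cov) u) small)) S'u

    -- Skipping v (when d = K and v has no neighbour in S'): keep S' unchanged.
    -- Degrees of vertices of S' do not see v, so their charges are unchanged.
    skip-admissible : 1 ≤ K → d ≡ K → (∀ t → S' t ≡ true → adj H v t ≡ false) →
                      Admissible A S'
    skip-admissible K≥1 d≡K isolated = record
      { within     = λ x S'x → ∖-⊆ A (within' x S'x)
      ; low-degree = λ x S'x → subst (_≤ K) (sym (deg-unchanged x S'x)) (low-degree' x S'x)
      ; budget     = budget-step S' (≤-reflexive (cong₂ _+_ potential-unchanged (cong (2 *_) d≡K)))
      ; forcing    = forcing
      }
      where
      deg-unchanged : ∀ x → S' x ≡ true → deg A x ≡ deg A' x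
      deg-unchanged x S'x = degIn-remove-non-adjacent H A v x Av (trans (adj-sym H x v) (isolated x S'x))
      potential-unchanged : potential A S' ≡ potential A' S'
      potential-unchanged = sum-cong same-charge
        where
        same-charge : ∀ x → charge A S' x ≡ charge A' S' x
        same-charge x with S' x in S'x
        ... | true  = cong (λ z → suc (K ∸ z)) (deg-unchanged x S'x)
        ... | false = refl
      -- if the image of v is a low vertex of B, delete it from B; otherwise it
      -- never needs a preimage
      forcing : Forcing A S'
      forcing {G} e B nonempty cov with degIn G B (map e v) ≤? K
      ... | yes small = forcing' e (B ∖ map e v)
                          (delete-nonempty v cov (subst (1 ≤_) (sym d≡K) K≥1))
                          (cover-delete-low v Av cov (≤-reflexive (sym d≡K)) small isolated)
      ... | no high   = forcing' e B nonempty (cover-drop-high v cov (≰⇒> high))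

    extend : 1 ≤ K → Σ VSet (Admissible A)
    extend K≥1 with any? (λ t → (S' t ∧ adj H v t) ≟ᵇ true)
    ... | yes (t , h) = added , added-admissible (inj₂ (t , ∧-elimˡ h , ∧-elimʳ {S' t} h))
    ... | no isolated with suc d ≤? K
    ...   | yes d<K = added , added-admissible (inj₁ d<K)
    ...   | no d≮K  = S' , skip-admissible K≥1 (≤-antisym d≤K (≤-pred (≰⇒> d≮K))) no-neighbour
      where
      no-neighbour : ∀ t → S' t ≡ true → adj H v t ≡ false
      no-neighbour t S't = ¬-not (λ vt → isolated (t , ∧-intro S't vt))

  admissible : ¬ MinDegSubgraph (suc K) H → 1 ≤ K →
               ∀ m (A : VSet) → count A ≡ m → Σ VSet (Admissible A)
  admissible noCore K≥1 zero A size = (λ _ → false) , empty-admissible A (count-zero A size)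
  admissible noCore K≥1 (suc m) A size
    with low-vertex K H noCore A (count-witness A (subst (1 ≤_) (sym size) (s≤s z≤n)))
  ... | v , Av , d≤K with admissible noCore K≥1 m (A ∖ v) (count-remove-size A v Av size)
  ...   | S' , adm = Step.extend A v Av d≤K S' adm K≥1

  -- Every selected vertex is charged at least 1.
  count-≤-potential : ∀ A S → count S ≤ potential A S
  count-≤-potential A S = subst (_≤ potential A S) (sym (count-as-sum S)) (sum-mono at-least-one)
    where
    at-least-one : ∀ x → ind (S x) ≤ charge A S x
    at-least-one x with S x
    ... | true  = s≤s z≤n
    ... | false = z≤n

  full : VSet
  full _ = true

  cover-covered : ∀ {S G} (c : Cover H S (suc K) G) → Covered (cover-embedding c) full S (λ _ → true)
  cover-covered {S} {G} c = record { image = λ _ _ → refl ; low = low }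
    where
    low : ∀ w → true ≡ true → degIn G (λ _ → true) w ≤ K →
          Σ (Fin (n H)) λ u → full u ≡ true × Cover.f c u ≡ w × S u ≡ false
    low w _ small with Cover.lowDeg c w small
    ... | v , fv≡w , Sv = v , refl , fv≡w , Sv

lemma10 : (k : ℕ) → 2 ≤ k → (H : Graph) → 1 ≤ vCount H →
          ¬ MinDegSubgraph k H →
          Σ (Fin (n H) → Bool) λ S →
            (∀ v → S v ≡ true → degree H v ≤ k ∸ 1) ×
            (count S + 2 * eCount H ≤ 2 * (k ∸ 1) * vCount H) ×
            ((G : Graph) → Cover H S k G → MinDegSubgraph k G)
lemma10 (suc K) (s≤s K≥1) H nonempty noCore = S , low-degree , size-bound , forces
  where
  open Construction K H
  result : Σ VSet (Admissible full)
  result = admissible noCore K≥1 (n H) full (count-full (n H))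
  S : VSet
  S = proj₁ result
  open Admissible (proj₂ result)
  size-bound : count S + 2 * eCount H ≤ 2 * K * n H
  size-bound = begin
    count S + 2 * eCount H                 ≤⟨ +-monoˡ-≤ (2 * eCount H) (count-≤-potential full S) ⟩
    potential full S + 2 * eCount H        ≡⟨ cong (potential full S +_) (handshake H) ⟩
    potential full S + edgeSum full        ≤⟨ budget ⟩
    2 * K * count full                     ≡⟨ cong (2 * K *_) (count-full (n H)) ⟩
    2 * K * n H                            ∎
    where open ≤-Reasoning
  forces : (G : Graph) → Cover H S (suc K) G → MinDegSubgraph (suc K) G
  forces G c = forcing (cover-embedding c) (λ _ → true) (Cover.f c (fromℕ< nonempty) , refl)
                       (cover-covered c)
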